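{- A formula $\varphi$ of $\mathcal{L}(\Rightarrow)$ is a theorem of the Yalcin logic if and only if $\varphi$ is a theorem of the logic defined in the same way as the Yalcin logic but with axioms A1–A4 in place of I1–I7.
   Context: The language $\mathcal{L}(\Rightarrow)$ is given by $\varphi::= p\mid \neg\varphi\mid (\varphi\wedge\varphi)\mid \Box\varphi \mid (\varphi\Rightarrow\varphi)$ over a fixed set of propositional variables; $\vee,\to,\leftrightarrow,\bot$ are defined as usual and $\Diamond\varphi:=\neg\Box\neg\varphi$. A formula is nonmodal if it contains neither $\Box$ nor $\Rightarrow$. The Yalcin logic is the smallest set of formulas closed under replacement of equivalents (if $\alpha\leftrightarrow\beta$ is in the set and $\varphi'$ results from $\varphi$ by replacing an occurrence of $\alpha$ by $\beta$, then $\varphi\leftrightarrow\varphi'$ is in the set), modus ponens for $\to$, and necessitation (from $\varphi$ infer $\Box\varphi$), and containing all substitution instances of propositional tautologies and all instances (for arbitrary formulas $\varphi,\psi,\alpha,\beta$ and nonmodal $\pi$) of: K: $\Box(\varphi\to\psi)\to(\Box\varphi\to\Box\psi)$; 4: $\Diamond\Diamond\varphi\to\Diamond\varphi$; 5: $\Diamond\Box\varphi\to\Box\varphi$; I1: $(\varphi\Rightarrow\pi)\leftrightarrow\Box(\varphi\to\pi)$; I2: $(\varphi\Rightarrow(\alpha\wedge\beta))\leftrightarrow((\varphi\Rightarrow\alpha)\wedge(\varphi\Rightarrow\beta))$; I3: $(\varphi\Rightarrow\alpha)\to(\varphi\Rightarrow(\alpha\vee\beta))$; I4: $(\varphi\Rightarrow\alpha)\to(\varphi\Rightarrow\Box\alpha)$;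 I5: $((\varphi\Rightarrow(\alpha\vee\Box\beta))\wedge\neg(\varphi\Rightarrow\beta))\to(\varphi\Rightarrow\alpha)$; I6: $((\varphi\Rightarrow(\alpha\vee\Diamond\beta))\wedge(\varphi\Rightarrow\neg\beta))\to(\varphi\Rightarrow\alpha)$; I7: $\neg(\varphi\Rightarrow\beta)\to(\varphi\Rightarrow\Diamond\neg\beta)$. The axioms A1–A4 are (for arbitrary $\varphi,\alpha,\beta$ and nonmodal $\pi$): A1: $(\varphi\Rightarrow\pi)\leftrightarrow\Box(\varphi\to\pi)$; A2: $(\varphi\Rightarrow(\alpha\wedge\beta))\leftrightarrow((\varphi\Rightarrow\alpha)\wedge(\varphi\Rightarrow\beta))$; A3: $(\varphi\Rightarrow(\alpha\vee\Box\beta))\leftrightarrow((\varphi\Rightarrow\alpha)\vee(\varphi\Rightarrow\beta))$; A4: $(\varphi\Rightarrow(\alpha\vee\Diamond\beta))\leftrightarrow((\varphi\Rightarrow\alpha)\vee\neg(\varphi\Rightarrow\neg\beta))$. -}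

module Defs where

open import Data.Nat using (ℕ)
open import Data.Bool using (Bool; true; false; not; _∧_)
open import Data.Product using (Σ; _×_)
open import Relation.Binary.PropositionalEquality using (_≡_)

infixr 30 _⇒_
data Fm : Set where
  var  : ℕ → Fm
  ¬'_  : Fm → Fm
  _∧'_ : Fm → Fm → Fm
  □_   : Fm → Fm
  _⇒_  : Fm → Fm → Fm

_∨'_ : Fm → Fm → Fm
a ∨' b = ¬' ((¬' a) ∧' (¬' b))

_→'_ : Fm → Fm → Fm
a →' b = ¬' (a ∧' (¬' b))

_↔'_ : Fm → Fm → Fm
a ↔' b = (a →' b) ∧' (b →' a)

◇_ : Fm → Fm
◇ a = ¬' (□ (¬' a))

data Nonmodal : Fm → Set where
  nm-var : ∀ n → Nonmodal (var n)
  nm-¬   : ∀ {a} → Nonmodal a → Nonmodal (¬' a)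
  nm-∧   : ∀ {a b} → Nonmodal a → Nonmodal b → Nonmodal (a ∧' b)

data PFm : Set where
  pvar : ℕ → PFm
  pneg : PFm → PFm
  pand : PFm → PFm → PFm

evalP : (ℕ → Bool) → PFm → Bool
evalP v (pvar n)   = v n
evalP v (pneg a)   = not (evalP v a)
evalP v (pand a b) = evalP v a ∧ evalP v b

Tautology : PFm → Set
Tautology t = (v : ℕ → Bool) → evalP v t ≡ true

substP : (ℕ → Fm) → PFm → Fm
substP σ (pvar n)   = σ n
substP σ (pneg a)   = ¬' substP σ a
substP σ (pand a b) = substP σ a ∧' substP σ b

data Ctx : Set where
  hole : Ctx
  c¬   : Ctx → Ctx
  c∧l  : Ctx → Fm → Ctx
  c∧r  : Fm → Ctx → Ctx
  c□   : Ctx → Ctx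
  c⇒l  : Ctx → Fm → Ctx
  c⇒r  : Fm → Ctx → Ctx

plug : Ctx → Fm → Fm
plug hole a      = a
plug (c¬ c) a    = ¬' plug c a
plug (c∧l c f) a = plug c a ∧' f
plug (c∧r f c) a = f ∧' plug c a
plug (c□ c) a    = □ plug c a
plug (c⇒l c f) a = plug c a ⇒ f
plug (c⇒r f c) a = f ⇒ plug c a

data BaseAx : Fm → Set where
  taut : ∀ t (σ : ℕ → Fm) → Tautology t → BaseAx (substP σ t)
  axK  : ∀ φ ψ → BaseAx ((□ (φ →' ψ)) →' ((□ φ) →' (□ ψ)))
  ax4  : ∀ φ → BaseAx ((◇ (◇ φ)) →' (◇ φ))
  ax5  : ∀ φ → BaseAx ((◇ (□ φ)) →' (□ φ))

data YalcinAx : Fm → Set where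
  I1 : ∀ φ π → Nonmodal π → YalcinAx ((φ ⇒ π) ↔' (□ (φ →' π)))
  I2 : ∀ φ α β → YalcinAx ((φ ⇒ (α ∧' β)) ↔' ((φ ⇒ α) ∧' (φ ⇒ β)))
  I3 : ∀ φ α β → YalcinAx ((φ ⇒ α) →' (φ ⇒ (α ∨' β)))
  I4 : ∀ φ α → YalcinAx ((φ ⇒ α) →' (φ ⇒ (□ α)))
  I5 : ∀ φ α β → YalcinAx (((φ ⇒ (α ∨' (□ β))) ∧' (¬' (φ ⇒ β))) →' (φ ⇒ α))
  I6 : ∀ φ α β → YalcinAx (((φ ⇒ (α ∨' (◇ β))) ∧' (φ ⇒ (¬' β))) →' (φ ⇒ α))
  I7 : ∀ φ β → YalcinAx ((¬' (φ ⇒ β)) →' (φ ⇒ (◇ (¬' β))))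

data AAx : Fm → Set where
  A1 : ∀ φ π → Nonmodal π → AAx ((φ ⇒ π) ↔' (□ (φ →' π)))
  A2 : ∀ φ α β → AAx ((φ ⇒ (α ∧' β)) ↔' ((φ ⇒ α) ∧' (φ ⇒ β)))
  A3 : ∀ φ α β → AAx ((φ ⇒ (α ∨' (□ β))) ↔' ((φ ⇒ α) ∨' (φ ⇒ β)))
  A4 : ∀ φ α β → AAx ((φ ⇒ (α ∨' (◇ β))) ↔' ((φ ⇒ α) ∨' (¬' (φ ⇒ (¬' β)))))

data Thm (Ax : Fm → Set) : Fm → Set where
  base : ∀ {φ} → BaseAx φ → Thm Ax φ
  ax   : ∀ {φ} → Ax φ → Thm Ax φ
  mp   : ∀ {φ ψ} → Thm Ax (φ →' ψ) → Thm Ax φ → Thm Ax ψ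
  nec  : ∀ {φ} → Thm Ax φ → Thm Ax (□ φ)
  re   : ∀ {α β} (c : Ctx) → Thm Ax (α ↔' β) → Thm Ax (plug c α ↔' plug c β)

YalcinThm : Fm → Set
YalcinThm = Thm YalcinAx

AThm : Fm → Set
AThm = Thm AAx

-- Both logics are generated by the same rules from the same base axioms, so
-- it suffices to derive every axiom of each system as a theorem of the other
-- (`theorems-transfer`).  I1 = A1 and I2 = A2; for the rest:
--   * I5 and I6 are the left-to-right halves of A3 and A4 (disjunctive
--     syllogism), and conversely these halves follow from I5 and I6;
--   * I3, I4, I7 follow from A2, A3, A4 instantiated at α ∧ (α ∨ β), ⊥ ∨ □α
--     and ⊥ ∨ ◇¬β, after rewriting inside φ ⇒ _ by replacement of equivalents;
--   * the right-to-left halves of A3, A4 combine I3 with I4 resp. I7.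
module Submission where

open import Defs
open import Data.Bool using (Bool; true; false; T; not; _∧_)
open import Data.Bool.Properties using (T-≡; T-∧)
open import Data.List using (List; []; _∷_)
open import Data.Nat using (ℕ; zero; suc; _⊔_; _≤_; _<_; s≤s)
open import Data.Nat.Properties using (m⊔n≤o⇒m≤o; m⊔n≤o⇒n≤o; ≤-refl)
open import Data.Product using (_×_; _,_; proj₁; proj₂)
open import Data.Vec using (Vec; []; _∷_)
open import Function using (_∘_)
open import Function.Bundles using (Equivalence)
open import Relation.Binary.PropositionalEquality using (_≡_; refl; sym; trans; cong; cong₂)

width : PFm → ℕ
width (pvar i)   = suc i
width (pneg a)   = width a
width (pand a b) = width a ⊔ width b

table : ∀ {n} → Vec Bool n → ℕ → Bool
table []       _       = false
table (b ∷ bs) zero    = b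
table (b ∷ bs) (suc i) = table bs i

restrict : ∀ n → (ℕ → Bool) → Vec Bool n
restrict zero    v = []
restrict (suc n) v = v 0 ∷ restrict n (v ∘ suc)

table-restrict : ∀ n v {i} → i < n → table (restrict n v) i ≡ v i
table-restrict (suc n) v {zero}  _         = refl
table-restrict (suc n) v {suc i} (s≤s i<n) = table-restrict n (v ∘ suc) i<n

evalP-restrict : ∀ {n} v t → width t ≤ n → evalP (table (restrict n v)) t ≡ evalP v t
evalP-restrict v (pvar i)   w≤n = table-restrict _ v w≤n
evalP-restrict v (pneg a)   w≤n = cong not (evalP-restrict v a w≤n)
evalP-restrict v (pand a b) w≤n =
  cong₂ _∧_ (evalP-restrict v a (m⊔n≤o⇒m≤o (width a) (width b) w≤n))
            (evalP-restrict v b (m⊔n≤o⇒n≤o (width a) (width b) w≤n))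

allTables : ∀ n → (Vec Bool n → Bool) → Bool
allTables zero    g = g []
allTables (suc n) g = allTables n (g ∘ (true ∷_)) ∧ allTables n (g ∘ (false ∷_))

allTables-sound : ∀ n g → T (allTables n g) → ∀ bs → T (g bs)
allTables-sound zero    g h []           = h
allTables-sound (suc n) g h (true ∷ bs)  =
  allTables-sound n (g ∘ (true ∷_)) (proj₁ (Equivalence.to T-∧ h)) bs
allTables-sound (suc n) g h (false ∷ bs) =
  allTables-sound n (g ∘ (false ∷_)) (proj₂ (Equivalence.to T-∧ h)) bs

isTautology : PFm → Bool
isTautology t = allTables (width t) (λ bs → evalP (table bs) t)

-- Soundness: v agrees with its own restriction to the variables of t.
isTautology-sound : ∀ t → T (isTautology t) → Tautology t
isTautology-sound t h v = trans (sym (evalP-restrict v t (≤-refl {width t})))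
  (Equivalence.to T-≡ (allTables-sound (width t) (λ bs → evalP (table bs) t) h (restrict (width t) v)))

infixr 5 _⊃_
infix  6 _≣_
infixl 7 _∥_
infixl 8 _&_

_&_ _⊃_ _∥_ _≣_ : PFm → PFm → PFm
a & b = pand a b
a ⊃ b = pneg (a & pneg b)
a ∥ b = pneg (pneg a & pneg b)
a ≣ b = (a ⊃ b) & (b ⊃ a)

x₀ x₁ x₂ : PFm
x₀ = pvar 0
x₁ = pvar 1
x₂ = pvar 2

⟨_⟩ : List Fm → ℕ → Fm
⟨ []    ⟩ i       = var i
⟨ a ∷ _ ⟩ zero    = a
⟨ _ ∷ σ ⟩ (suc i) = ⟨ σ ⟩ i

⊥' : Fm
⊥' = var 0 ∧' (¬' var 0)

module Propositional {Ax : Fm → Set} where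

  tautology : (t : PFm) {_ : T (isTautology t)} (σ : List Fm) → Thm Ax (substP ⟨ σ ⟩ t)
  tautology t {h} σ = base (taut t ⟨ σ ⟩ (isTautology-sound t h))

  ↔-to : ∀ {a b} → Thm Ax (a ↔' b) → Thm Ax (a →' b)
  ↔-to {a} {b} = mp (tautology ((x₀ ≣ x₁) ⊃ x₀ ⊃ x₁) (a ∷ b ∷ []))

  ↔-from : ∀ {a b} → Thm Ax (a ↔' b) → Thm Ax (b →' a)
  ↔-from {a} {b} = mp (tautology ((x₀ ≣ x₁) ⊃ x₁ ⊃ x₀) (a ∷ b ∷ []))

  ↔-intro : ∀ {a b} → Thm Ax (a →' b) → Thm Ax (b →' a) → Thm Ax (a ↔' b)
  ↔-intro {a} {b} ab ba = mp (mp (tautology ((x₀ ⊃ x₁) ⊃ (x₁ ⊃ x₀) ⊃ (x₀ ≣ x₁)) (a ∷ b ∷ [])) ab) ba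

  →-trans : ∀ {a b c} → Thm Ax (a →' b) → Thm Ax (b →' c) → Thm Ax (a →' c)
  →-trans {a} {b} {c} ab bc =
    mp (mp (tautology ((x₀ ⊃ x₁) ⊃ (x₁ ⊃ x₂) ⊃ (x₀ ⊃ x₂)) (a ∷ b ∷ c ∷ [])) ab) bc

  ∨-injʳ : ∀ a b → Thm Ax (b →' (a ∨' b))
  ∨-injʳ a b = tautology (x₁ ⊃ x₀ ∥ x₁) (a ∷ b ∷ [])

  ∨-elim : ∀ {a b c} → Thm Ax (a →' c) → Thm Ax (b →' c) → Thm Ax ((a ∨' b) →' c)
  ∨-elim {a} {b} {c} ac bc =
    mp (mp (tautology ((x₀ ⊃ x₂) ⊃ (x₁ ⊃ x₂) ⊃ (x₀ ∥ x₁ ⊃ x₂)) (a ∷ b ∷ c ∷ [])) ac) bc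

  →-∧-projʳ : ∀ {x a b} → Thm Ax (x →' (a ∧' b)) → Thm Ax (x →' b)
  →-∧-projʳ {x} {a} {b} = mp (tautology ((x₀ ⊃ x₁ & x₂) ⊃ (x₀ ⊃ x₂)) (x ∷ a ∷ b ∷ []))

  ∨-syllogism : ∀ {x a b} → Thm Ax (x →' (a ∨' b)) → Thm Ax ((x ∧' (¬' b)) →' a)
  ∨-syllogism {x} {a} {b} =
    mp (tautology ((x₀ ⊃ x₁ ∥ x₂) ⊃ (x₀ & pneg x₂ ⊃ x₁)) (x ∷ a ∷ b ∷ []))

  ∨-syllogism⁻¹ : ∀ {x a b} → Thm Ax ((x ∧' (¬' b)) →' a) → Thm Ax (x →' (a ∨' b))
  ∨-syllogism⁻¹ {x} {a} {b} =
    mp (tautology ((x₀ & pneg x₂ ⊃ x₁) ⊃ (x₀ ⊃ x₁ ∥ x₂)) (x ∷ a ∷ b ∷ []))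

  ∨¬-syllogism : ∀ {x a b} → Thm Ax (x →' (a ∨' (¬' b))) → Thm Ax ((x ∧' b) →' a)
  ∨¬-syllogism {x} {a} {b} =
    mp (tautology ((x₀ ⊃ x₁ ∥ pneg x₂) ⊃ (x₀ & x₂ ⊃ x₁)) (x ∷ a ∷ b ∷ []))

  ∨¬-syllogism⁻¹ : ∀ {x a b} → Thm Ax ((x ∧' b) →' a) → Thm Ax (x →' (a ∨' (¬' b)))
  ∨¬-syllogism⁻¹ {x} {a} {b} =
    mp (tautology ((x₀ & x₂ ⊃ x₁) ⊃ (x₀ ⊃ x₁ ∥ pneg x₂)) (x ∷ a ∷ b ∷ []))

  absorption : ∀ a b → Thm Ax (a ↔' (a ∧' (a ∨' b)))
  absorption a b = tautology (x₀ ≣ x₀ & (x₀ ∥ x₁)) (a ∷ b ∷ [])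

  ⊥-∨-unit : ∀ a → Thm Ax (a ↔' (⊥' ∨' a))
  ⊥-∨-unit a = tautology (x₀ ≣ (x₁ & pneg x₁) ∥ x₀) (a ∷ var 0 ∷ [])

  double-negation : ∀ a → Thm Ax ((¬' (¬' a)) ↔' a)
  double-negation a = tautology (pneg (pneg x₀) ≣ x₀) (a ∷ [])

  ∨-comm : ∀ a b → Thm Ax ((a ∨' b) ↔' (b ∨' a))
  ∨-comm a b = tautology (x₀ ∥ x₁ ≣ x₁ ∥ x₀) (a ∷ b ∷ [])

  ⇒-congʳ : ∀ φ {a b} → Thm Ax (a ↔' b) → Thm Ax ((φ ⇒ a) ↔' (φ ⇒ b))
  ⇒-congʳ φ = re (c⇒r φ hole)

module YalcinFromA where
  open Propositional {AAx}

  I3-derived : ∀ φ α β → AThm ((φ ⇒ α) →' (φ ⇒ (α ∨' β)))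
  I3-derived φ α β =
    →-trans (↔-to (⇒-congʳ φ (absorption α β))) (→-∧-projʳ (↔-to (ax (A2 φ α (α ∨' β)))))

  I4-derived : ∀ φ α → AThm ((φ ⇒ α) →' (φ ⇒ (□ α)))
  I4-derived φ α =
    →-trans (∨-injʳ (φ ⇒ ⊥') (φ ⇒ α))
   (→-trans (↔-from (ax (A3 φ ⊥' α)))
            (↔-from (⇒-congʳ φ (⊥-∨-unit (□ α)))))

  I5-derived : ∀ φ α β → AThm (((φ ⇒ (α ∨' (□ β))) ∧' (¬' (φ ⇒ β))) →' (φ ⇒ α))
  I5-derived φ α β = ∨-syllogism (↔-to (ax (A3 φ α β)))

  I6-derived : ∀ φ α β → AThm (((φ ⇒ (α ∨' (◇ β))) ∧' (φ ⇒ (¬' β))) →' (φ ⇒ α))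
  I6-derived φ α β = ∨¬-syllogism (↔-to (ax (A4 φ α β)))

  -- ¬(φ ⇒ β) gives ¬(φ ⇒ ¬¬β), hence φ ⇒ (⊥ ∨ ◇¬β) by A4, i.e. φ ⇒ ◇¬β.
  I7-derived : ∀ φ β → AThm ((¬' (φ ⇒ β)) →' (φ ⇒ (◇ (¬' β))))
  I7-derived φ β =
    →-trans (↔-from (re (c¬ (c⇒r φ hole)) (double-negation β)))
   (→-trans (∨-injʳ (φ ⇒ ⊥') (¬' (φ ⇒ (¬' (¬' β)))))
   (→-trans (↔-from (ax (A4 φ ⊥' (¬' β))))
            (↔-from (⇒-congʳ φ (⊥-∨-unit (◇ (¬' β)))))))

  axiom : ∀ {χ} → YalcinAx χ → AThm χ
  axiom (I1 φ π nm) = ax (A1 φ π nm)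
  axiom (I2 φ α β)  = ax (A2 φ α β)
  axiom (I3 φ α β)  = I3-derived φ α β
  axiom (I4 φ α)    = I4-derived φ α
  axiom (I5 φ α β)  = I5-derived φ α β
  axiom (I6 φ α β)  = I6-derived φ α β
  axiom (I7 φ β)    = I7-derived φ β

module AFromYalcin where
  open Propositional {YalcinAx}

  -- ⇐ : φ ⇒ α gives φ ⇒ (α ∨ □β) by I3; φ ⇒ β gives φ ⇒ □β by I4, then I3.
  A3-derived : ∀ φ α β → YalcinThm ((φ ⇒ (α ∨' (□ β))) ↔' ((φ ⇒ α) ∨' (φ ⇒ β)))
  A3-derived φ α β = ↔-intro
    (∨-syllogism⁻¹ (ax (I5 φ α β)))
    (∨-elim (ax (I3 φ α (□ β)))
            (→-trans (ax (I4 φ β))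
            (→-trans (ax (I3 φ (□ β) α))
                     (↔-to (⇒-congʳ φ (∨-comm (□ β) α))))))

  -- ⇐ : ¬(φ ⇒ ¬β) gives φ ⇒ ◇¬¬β by I7, i.e. φ ⇒ ◇β, then I3.
  A4-derived : ∀ φ α β → YalcinThm ((φ ⇒ (α ∨' (◇ β))) ↔' ((φ ⇒ α) ∨' (¬' (φ ⇒ (¬' β)))))
  A4-derived φ α β = ↔-intro
    (∨¬-syllogism⁻¹ (ax (I6 φ α β)))
    (∨-elim (ax (I3 φ α (◇ β)))
            (→-trans (ax (I7 φ (¬' β)))
            (→-trans (↔-to (re (c⇒r φ (c¬ (c□ hole))) (double-negation (¬' β))))
            (→-trans (ax (I3 φ (◇ β) α))
                     (↔-to (⇒-congʳ φ (∨-comm (◇ β) α)))))))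

  axiom : ∀ {χ} → AAx χ → YalcinThm χ
  axiom (A1 φ π nm) = ax (I1 φ π nm)
  axiom (A2 φ α β)  = ax (I2 φ α β)
  axiom (A3 φ α β)  = A3-derived φ α β
  axiom (A4 φ α β)  = A4-derived φ α β

theorems-transfer : ∀ {Ax Bx : Fm → Set} → (∀ {χ} → Ax χ → Thm Bx χ) → ∀ {χ} → Thm Ax χ → Thm Bx χ
theorems-transfer axiom (base b) = base b
theorems-transfer axiom (ax a)   = axiom a
theorems-transfer axiom (mp d e) = mp (theorems-transfer axiom d) (theorems-transfer axiom e)
theorems-transfer axiom (nec d)  = nec (theorems-transfer axiom d)
theorems-transfer axiom (re c d) = re c (theorems-transfer axiom d)

lemma3 : (φ : Fm) → ((YalcinThm φ → AThm φ) × (AThm φ → YalcinThm φ))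
lemma3 φ = theorems-transfer YalcinFromA.axiom , theorems-transfer AFromYalcin.axiom
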